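{- For integers $n,m\geq 3$ and positive integers $q_1,\dots,q_n,r_1,\dots,r_n,s_1,\dots,s_m,p_1,\dots,p_m$, $$\dim_s\big(K_{n,n}^{ -M}(q_1,\dots,q_n,r_1,\dots,r_n)\diamond K_{m,m}^{ -M}(s_1,\dots,s_m,p_1,\dots,p_m)\big)=\sum_{i=1}^n\left((q_i+r_i)\sum_{j=1}^m(s_j+p_j)\right)-nm.$$
   Context: $K_{n,n}^{ -M}$ is $K_{n,n}$ with parts $\{x_1,\dots,x_n\}$, $\{y_1,\dots,y_n\}$ minus the perfect matching $\{x_iy_i\}$; $K_{n,n}^{ -M}(q_1,\dots,q_n,r_1,\dots,r_n)$ is obtained by replacing each $x_i$ by a clique on $q_i$ vertices and each $y_i$ by a clique on $r_i$ vertices (each vertex of a replacing clique is adjacent to the rest of its clique and to all vertices of the cliques replacing the neighbors of the original vertex). The modular product $G\diamond H$ has vertex set $V(G)\times V(H)$, and $(g,h)$, $(g',h')$ are adjacent if $g=g'$ and $hh'\in E(H)$, or $gg'\in E(G)$ and $h=h'$, or $gg'\in E(G)$ and $hh'\in E(H)$, or ($g\neq g'$, $h\neq h'$, $gg'\notin E(G)$ and $hh'\notin E(H)$). $\dim_s(X)$ is the strong metric dimension: the minimum size of $S\subseteq V(X)$ such that for all distinct $x,y$ some $z\in S$ satisfies $d_X(y,z)=d_X(y,x)+d_X(x,z)$ or $d_X(x,z)=d_X(x,y)+d_X(y,z)$. -}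

module Defs where

open import Level using (0ℓ)
open import Data.Nat using (ℕ; zero; suc; _+_; _*_; _≤_)
open import Data.Fin using (Fin; zero; suc)
open import Data.Sum using (_⊎_; inj₁; inj₂)
open import Data.Product using (Σ; Σ-syntax; _×_; _,_)
open import Data.List using (List; length)
open import Data.List.Membership.Propositional using (_∈_)
open import Data.List.Relation.Unary.Unique.Propositional using (Unique)
open import Relation.Binary.PropositionalEquality using (_≡_; _≢_)
open import Relation.Nullary using (¬_)
open import Data.Empty using (⊥)

record Graph : Set₁ where
  field
    V   : Set
    Adj : V → V → Set
open Graph public

data Walk (G : Graph) : V G → V G → ℕ → Set where
  nil  : ∀ x → Walk G x x 0
  cons : ∀ {x y z k} → Adj G x y → Walk G y z k → Walk G x z (suc k)

Dist : (G : Graph) → V G → V G → ℕ → Set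
Dist G x y k = Walk G x y k × (∀ j → Walk G x y j → k ≤ j)

StronglyResolves : (G : Graph) → V G → V G → V G → Set
StronglyResolves G x y z =
  (Σ[ a ∈ ℕ ] Σ[ b ∈ ℕ ] Σ[ c ∈ ℕ ]
     (Dist G y z a × Dist G y x b × Dist G x z c × a ≡ b + c))
  ⊎
  (Σ[ a ∈ ℕ ] Σ[ b ∈ ℕ ] Σ[ c ∈ ℕ ]
     (Dist G x z a × Dist G x y b × Dist G y z c × a ≡ b + c))

IsStrongResolving : (G : Graph) → List (V G) → Set
IsStrongResolving G S =
  ∀ x y → x ≢ y → Σ[ z ∈ V G ] (z ∈ S × StronglyResolves G x y z)

StrongMetricDim : (G : Graph) → ℕ → Set
StrongMetricDim G k =
  (Σ[ S ∈ List (V G) ] (Unique S × IsStrongResolving G S × length S ≡ k))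
  × (∀ (S : List (V G)) → Unique S → IsStrongResolving G S → k ≤ length S)

-- K_{n,n}^{-M}(q_1..q_n, r_1..r_n): vertex (i , inj₁ a) is the a-th vertex of
-- the clique replacing x_i, (i , inj₂ b) the b-th vertex of the clique
-- replacing y_i.
KnnMBlowupV : (n : ℕ) (q r : Fin n → ℕ) → Set
KnnMBlowupV n q r = Σ[ i ∈ Fin n ] (Fin (q i) ⊎ Fin (r i))

KnnMBlowupAdj : (n : ℕ) (q r : Fin n → ℕ) →
  KnnMBlowupV n q r → KnnMBlowupV n q r → Set
KnnMBlowupAdj n q r (i , inj₁ a) (j , inj₁ b) = Σ[ e ∈ i ≡ j ] ¬ (_≡_ {A = KnnMBlowupV n q r} (i , inj₁ a) (j , inj₁ b))
KnnMBlowupAdj n q r (i , inj₂ a) (j , inj₂ b) = Σ[ e ∈ i ≡ j ] ¬ (_≡_ {A = KnnMBlowupV n q r} (i , inj₂ a) (j , inj₂ b))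
KnnMBlowupAdj n q r (i , inj₁ a) (j , inj₂ b) = i ≢ j
KnnMBlowupAdj n q r (i , inj₂ a) (j , inj₁ b) = i ≢ j

KnnMBlowup : (n : ℕ) (q r : Fin n → ℕ) → Graph
KnnMBlowup n q r = record
  { V   = KnnMBlowupV n q r
  ; Adj = KnnMBlowupAdj n q r }

_◇_ : Graph → Graph → Graph
G ◇ H = record
  { V   = V G × V H
  ; Adj = λ { (g , h) (g' , h') →
        ((g ≡ g') × Adj H h h')
      ⊎ (Adj G g g' × (h ≡ h'))
      ⊎ (Adj G g g' × Adj H h h')
      ⊎ (g ≢ g' × h ≢ h' × ¬ Adj G g g' × ¬ Adj H h h') } }

∑ : (n : ℕ) → (Fin n → ℕ) → ℕ
∑ zero    f = 0
∑ (suc n) f = f zero + ∑ n (λ i → f (suc i))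

{-# OPTIONS --safe #-}
-- Closed adjacency in K_{n,n}^{-M}(q,r) is a Boolean test: u ∈ N[v] iff "same row" agrees with
-- "same side".  In the modular product the test is the XNOR of the factors' tests, so for two
-- vertices u, v of one block (same rows in both factors) N[u] is either N[v] or its complement.
-- Hence u, v are closed twins or at distance 3, the diameter; either way they are mutually
-- maximally distant, so every strong resolving set misses at most one vertex per block, and
-- dim_s ≥ |V| − nm.  Conversely, dropping the representative (x_i, x′_j) of each block leaves a
-- strong resolving set: a non-representative resolves every pair it belongs to, and two
-- representatives lie on a geodesic of length 2 or 3 ending in a non-representative.
module Submission where

open import Defs
open import Data.Bool using (Bool; true; false; not; _xor_; if_then_else_)
import Data.Bool as Bool
open import Data.Bool.Properties
  using (not-involutive; not-¬; ¬-not; not-distribˡ-xor; not-distribʳ-xor; xor-comm; xor-same)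
open import Level using (0ℓ)
open import Data.Empty using (⊥-elim)
open import Data.Fin using (Fin; zero; suc; fromℕ<)
open import Data.Fin.Properties using (_≟_)
open import Data.List using (List; []; _∷_; _++_; length; map; filter; allFin; cartesianProduct)
open import Data.List.Properties using (length-++; length-map; length-tabulate)
open import Data.List.Membership.Propositional using (_∈_; lose)
open import Data.List.Membership.Propositional.Properties
  using ( ∈-++⁺ˡ; ∈-++⁺ʳ; ∈-++⁻; ∈-∃++; ∈-map⁺; ∈-map⁻; ∈-filter⁺; ∈-filter⁻; ∈-allFin
        ; ∈-cartesianProduct⁺)
import Data.List.Relation.Unary.All as All
open import Data.List.Relation.Unary.Any using (here; there; any?; satisfied)
open import Data.List.Relation.Unary.AllPairs using ([]; _∷_)
open import Data.List.Relation.Unary.Unique.Propositional using (Unique)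
import Data.List.Relation.Unary.Unique.Propositional.Properties as Unique
open import Data.Nat using (ℕ; zero; suc; _+_; _*_; _∸_; _≤_; _⊔_; z≤n; s≤s)
open import Data.Nat.Properties
  using ( ≤-refl; ≤-trans; ≤-reflexive; ≤-antisym; <⇒≱; n<1+n; +-suc; +-comm; +-identityʳ
        ; +-mono-≤; +-mono-≤-<; ⊔-lub; *-distribʳ-+; m≤n+o⇒m∸n≤o; m+n≤o⇒m≤o∸n; module ≤-Reasoning)
open import Data.Product using (Σ; ∃-syntax; _×_; _,_; proj₁; proj₂)
import Data.Product.Properties as Product
open import Data.Sum using (_⊎_; inj₁; inj₂; [_,_]; swap; map₂)
import Data.Sum.Properties as Sum
open import Function using (id; _∘_)
open import Relation.Binary.Definitions using (DecidableEquality)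
open import Relation.Binary.PropositionalEquality
  using (_≡_; _≢_; refl; sym; trans; cong; cong₂; subst; module ≡-Reasoning)
open import Relation.Nullary using (¬_; Dec; yes; no; does; contradiction)
open import Relation.Nullary.Decidable using (map′; toSum; _×-dec_; _⊎-dec_; ¬?; dec-true; dec-false)
open import Relation.Unary using (Pred; Decidable)
open import Relation.Unary.Properties using (∁?)

least : {P : ℕ → Set} → (∀ k → Dec (P k)) → ∀ d → P d → ∃[ k ] (P k × (∀ j → P j → k ≤ j))
least P? d pd with P? 0
... | yes p0 = 0 , p0 , λ _ _ → z≤n
least P? zero    pd | no ¬p0 = contradiction pd ¬p0
least P? (suc d) pd | no ¬p0 with least (P? ∘ suc) d pd
... | k , pk , min = suc k , pk , λ { zero p0 → contradiction p0 ¬p0 ; (suc j) pj → s≤s (min j pj) }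

module _ {A : Set} where

  length-filter+∁ : {P : Pred A 0ℓ} (P? : Decidable P) (xs : List A) →
                    length (filter P? xs) + length (filter (∁? P?) xs) ≡ length xs
  length-filter+∁ P? []       = refl
  length-filter+∁ P? (x ∷ xs) with P? x
  ... | yes _ = cong suc (length-filter+∁ P? xs)
  ... | no  _ = trans (+-suc _ _) (cong suc (length-filter+∁ P? xs))

  ∈-++-∷⁻ : ∀ {v u : A} ys zs → v ∈ ys ++ u ∷ zs → v ≢ u → v ∈ ys ++ zs
  ∈-++-∷⁻ ys zs v∈ v≢u with ∈-++⁻ ys v∈
  ... | inj₁ v∈ys          = ∈-++⁺ˡ v∈ys
  ... | inj₂ (here v≡u)    = contradiction v≡u v≢u
  ... | inj₂ (there v∈zs)  = ∈-++⁺ʳ ys v∈zs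

  length-++-∷ : ∀ (u : A) ys zs → length (ys ++ u ∷ zs) ≡ suc (length (ys ++ zs))
  length-++-∷ u ys zs = begin
    length (ys ++ u ∷ zs)          ≡⟨ length-++ ys ⟩
    length ys + suc (length zs)    ≡⟨ +-suc (length ys) (length zs) ⟩
    suc (length ys + length zs)    ≡⟨ cong suc (length-++ ys) ⟨
    suc (length (ys ++ zs))        ∎
    where open ≡-Reasoning

module _ {A B : Set} where

  length-injection : ∀ {xs : List A} {ys : List B} (f : A → B) → Unique xs →
                     (∀ {x y} → x ∈ xs → y ∈ xs → f x ≡ f y → x ≡ y) →
                     (∀ {x} → x ∈ xs → f x ∈ ys) → length xs ≤ length ys
  length-injection {xs = []}     f _ _ _ = z≤n
  length-injection {xs = x ∷ xs} f (x∉xs ∷ xs!) inj into with ∈-∃++ (into (here refl))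
  ... | ys₁ , ys₂ , refl = begin
    suc (length xs)              ≤⟨ s≤s (length-injection f xs! (λ a b → inj (there a) (there b)) into′) ⟩
    suc (length (ys₁ ++ ys₂))    ≡⟨ length-++-∷ (f x) ys₁ ys₂ ⟨
    length (ys₁ ++ f x ∷ ys₂)    ∎
    where
    open ≤-Reasoning
    into′ : ∀ {y} → y ∈ xs → f y ∈ ys₁ ++ ys₂
    into′ y∈xs = ∈-++-∷⁻ ys₁ ys₂ (into (there y∈xs))
                   (λ fy≡fx → All.lookup x∉xs y∈xs (sym (inj (there y∈xs) (here refl) fy≡fx)))

module _ {A B : Set} where

  length≤fibres+hittingSet : DecidableEquality A → (f : A → B) (bs : List B) → (∀ x → f x ∈ bs) →
    ∀ {xs} → Unique xs → (S : List A) → (∀ {x y} → x ≢ y → f x ≡ f y → x ∈ S ⊎ y ∈ S) →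
    length xs ≤ length bs + length S
  length≤fibres+hittingSet _≟ᴬ_ f bs f∈bs {xs} xs! S hits = begin
    length xs                          ≡⟨ length-filter+∁ (_∈? S) xs ⟨
    length inside + length outside     ≤⟨ +-mono-≤ inside≤S outside≤bs ⟩
    length S + length bs               ≡⟨ +-comm (length S) (length bs) ⟩
    length bs + length S               ∎
    where
    open ≤-Reasoning
    open import Data.List.Membership.DecPropositional _≟ᴬ_ using (_∈?_)
    inside outside : List A
    inside  = filter (_∈? S) xs
    outside = filter (∁? (_∈? S)) xs
    inside≤S : length inside ≤ length S
    inside≤S = length-injection id (Unique.filter⁺ (_∈? S) xs!) (λ _ _ → id)
                 (proj₂ ∘ ∈-filter⁻ (_∈? S) {xs = xs})
    outside-injective : ∀ {x y} → x ∈ outside → y ∈ outside → f x ≡ f y → x ≡ y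
    outside-injective {x} {y} x∈ y∈ fx≡fy with x ≟ᴬ y
    ... | yes x≡y = x≡y
    ... | no  x≢y = ⊥-elim ([ ∉S x∈ , ∉S y∈ ] (hits x≢y fx≡fy))
      where
      ∉S : ∀ {v} → v ∈ outside → ¬ (v ∈ S)
      ∉S v∈ = proj₂ (∈-filter⁻ (∁? (_∈? S)) {xs = xs} v∈)
    outside≤bs : length outside ≤ length bs
    outside≤bs = length-injection f (Unique.filter⁺ (∁? (_∈? S)) xs!) outside-injective (λ {x} _ → f∈bs x)

avoid₂ : ∀ {n} → 3 ≤ n → (i j : Fin n) → ∃[ t ] (t ≢ i × t ≢ j)
avoid₂ _                   (suc _)       (suc _)       = zero , (λ ()) , (λ ())
avoid₂ _                   zero          (suc (suc _)) = suc zero , (λ ()) , (λ ())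
avoid₂ _                   (suc (suc _)) zero          = suc zero , (λ ()) , (λ ())
avoid₂ (s≤s (s≤s (s≤s _))) zero          zero          = suc zero , (λ ()) , (λ ())
avoid₂ (s≤s (s≤s (s≤s _))) zero          (suc zero)    = suc (suc zero) , (λ ()) , (λ ())
avoid₂ (s≤s (s≤s (s≤s _))) (suc zero)    zero          = suc (suc zero) , (λ ()) , (λ ())

module _ {k : ℕ} {B : Fin (suc k) → Set} where

  shiftΣ : Σ (Fin k) (B ∘ suc) → Σ (Fin (suc k)) B
  shiftΣ (i , b) = suc i , b

allFinΣ : ∀ k {B : Fin k → Set} → (∀ i → List (B i)) → List (Σ (Fin k) B)
allFinΣ zero    L = []
allFinΣ (suc k) L = map (zero ,_) (L zero) ++ map shiftΣ (allFinΣ k (L ∘ suc))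

length-allFinΣ : ∀ k {B : Fin k → Set} (L : ∀ i → List (B i)) {f : Fin k → ℕ} →
                 (∀ i → length (L i) ≡ f i) → length (allFinΣ k L) ≡ ∑ k f
length-allFinΣ zero    L len = refl
length-allFinΣ (suc k) L len =
  trans (length-++ (map (zero ,_) (L zero)))
        (cong₂ _+_ (trans (length-map _ (L zero)) (len zero))
                   (trans (length-map shiftΣ (allFinΣ k (L ∘ suc))) (length-allFinΣ k (L ∘ suc) (len ∘ suc))))

∈-allFinΣ : ∀ k {B : Fin k → Set} (L : ∀ i → List (B i)) {i b} → b ∈ L i → (i , b) ∈ allFinΣ k L
∈-allFinΣ (suc k) L {zero}  b∈ = ∈-++⁺ˡ (∈-map⁺ (zero ,_) b∈)
∈-allFinΣ (suc k) L {suc i} b∈ =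
  ∈-++⁺ʳ (map (zero ,_) (L zero)) (∈-map⁺ shiftΣ (∈-allFinΣ k (L ∘ suc) b∈))

allFinΣ-Unique : ∀ k {B : Fin k → Set} (L : ∀ i → List (B i)) →
                 (∀ i → Unique (L i)) → Unique (allFinΣ k L)
allFinΣ-Unique zero    L L! = []
allFinΣ-Unique (suc k) L L! =
  Unique.++⁺ (Unique.map⁺ (λ { refl → refl }) (L! zero))
             (Unique.map⁺ (λ { {_ , _} {_ , _} refl → refl }) (allFinΣ-Unique k (L ∘ suc) (L! ∘ suc)))
             disjoint
  where
  disjoint : ∀ {v} → ¬ (v ∈ map (zero ,_) (L zero) × v ∈ map shiftΣ (allFinΣ k (L ∘ suc)))
  disjoint (v∈₁ , v∈₂) with ∈-map⁻ (zero ,_) v∈₁ | ∈-map⁻ shiftΣ v∈₂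
  ... | _ , _ , refl | _ , _ , ()

length-cartesianProduct : ∀ {A B : Set} (xs : List A) (ys : List B) →
                          length (cartesianProduct xs ys) ≡ length xs * length ys
length-cartesianProduct []       ys = refl
length-cartesianProduct (x ∷ xs) ys =
  trans (length-++ (map (x ,_) ys)) (cong₂ _+_ (length-map (x ,_) ys) (length-cartesianProduct xs ys))

∑-*ʳ : ∀ k (f : Fin k → ℕ) c → ∑ k f * c ≡ ∑ k (λ i → f i * c)
∑-*ʳ zero    f c = refl
∑-*ʳ (suc k) f c = trans (*-distribʳ-+ c (f zero) (∑ k (f ∘ suc))) (cong (f zero * c +_) (∑-*ʳ k (f ∘ suc) c))

xor-shift : ∀ r a b c → r xor (a xor c) ≡ (a xor b) xor (r xor (b xor c))
xor-shift r false false c = refl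
xor-shift r true  true  c = refl
xor-shift r true  false c = sym (not-distribʳ-xor r c)
xor-shift r false true  c = sym (trans (not-distribʳ-xor r (not c)) (cong (r xor_) (not-involutive c)))

DiameterAtMost : Graph → ℕ → Set
DiameterAtMost Γ d = ∀ x y → ∃[ k ] (k ≤ d × Walk Γ x y k)

MaximallyDistantFrom : (Γ : Graph) → V Γ → V Γ → Set
MaximallyDistantFrom Γ x y = ∀ {b} → Dist Γ y x b → ∀ {w} → Adj Γ x w → ∃[ k ] (k ≤ b × Walk Γ y w k)

module GraphProperties (Γ : Graph) where

  _++ʷ_ : ∀ {x y z a b} → Walk Γ x y a → Walk Γ y z b → Walk Γ x z (a + b)
  nil _    ++ʷ q = q
  cons e p ++ʷ q = cons e (p ++ʷ q)

  edge : ∀ {x y} → Adj Γ x y → Walk Γ x y 1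
  edge e = cons e (nil _)

  ≢⇒1≤length : ∀ {x y j} → x ≢ y → Walk Γ x y j → 1 ≤ j
  ≢⇒1≤length x≢y (nil _)    = contradiction refl x≢y
  ≢⇒1≤length _   (cons _ _) = s≤s z≤n

  adjacent⇒Dist1 : ∀ {x y} → x ≢ y → Adj Γ x y → Dist Γ x y 1
  adjacent⇒Dist1 x≢y e = edge e , λ _ → ≢⇒1≤length x≢y

  geodesic⇒resolves : ∀ {x y z b c} → Dist Γ y x b → Dist Γ x z c →
                      (∀ j → Walk Γ y z j → b + c ≤ j) → StronglyResolves Γ x y z
  geodesic⇒resolves dyx@(p , _) dxz@(q , _) shortest = inj₁ (_ , _ , _ , (p ++ʷ q , shortest) , dyx , dxz , refl)

  resolves-self : ∀ {x y b} → Dist Γ y x b → StronglyResolves Γ x y x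
  resolves-self {b = b} dyx@(_ , shortest) =
    geodesic⇒resolves dyx (nil _ , λ _ _ → z≤n) (λ j p → ≤-trans (≤-reflexive (+-identityʳ b)) (shortest j p))

  StronglyResolves-sym : ∀ {x y z} → StronglyResolves Γ y x z → StronglyResolves Γ x y z
  StronglyResolves-sym = swap

  maximallyDistant⇒resolver≡ : ∀ {x y z a b c} → MaximallyDistantFrom Γ x y →
    Dist Γ y z a → Dist Γ y x b → Dist Γ x z c → a ≡ b + c → z ≡ x
  maximallyDistant⇒resolver≡ md _ _ (nil _ , _) _ = refl
  maximallyDistant⇒resolver≡ md (_ , shortest) dyx (cons {k = c} e q , _) refl with md dyx e
  ... | k , k≤b , p = contradiction (shortest _ (p ++ʷ q)) (<⇒≱ (+-mono-≤-< k≤b (n<1+n c)))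

  strongResolving-meets : ∀ {S x y} → IsStrongResolving Γ S → x ≢ y →
    MaximallyDistantFrom Γ x y → MaximallyDistantFrom Γ y x → x ∈ S ⊎ y ∈ S
  strongResolving-meets {S} {x} {y} resolving x≢y mdx mdy with resolving x y x≢y
  ... | z , z∈S , inj₁ (_ , _ , _ , dyz , dyx , dxz , eq) =
    inj₁ (subst (_∈ S) (maximallyDistant⇒resolver≡ mdx dyz dyx dxz eq) z∈S)
  ... | z , z∈S , inj₂ (_ , _ , _ , dxz , dxy , dyz , eq) =
    inj₂ (subst (_∈ S) (maximallyDistant⇒resolver≡ mdy dxz dxy dyz eq) z∈S)

  module _ (_≟ᵛ_ : DecidableEquality (V Γ)) (adj? : ∀ x y → Dec (Adj Γ x y))
           (vertices : List (V Γ)) (∈-vertices : ∀ x → x ∈ vertices) where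

    walk? : ∀ k x y → Dec (Walk Γ x y k)
    walk? zero    x y = map′ (λ { refl → nil x }) (λ { (nil _) → refl }) (x ≟ᵛ y)
    walk? (suc k) x y = map′ (λ first → let (_ , e , p) = satisfied {P = FirstStep} first in cons e p)
                             (λ { (cons e p) → lose {P = FirstStep} (∈-vertices _) (e , p) })
                             (any? (λ w → adj? x w ×-dec walk? k w y) vertices)
      where
      FirstStep : V Γ → Set
      FirstStep w = Adj Γ x w × Walk Γ w y k

    walk⇒Dist : ∀ {x y d} → Walk Γ x y d → ∃[ k ] Dist Γ x y k
    walk⇒Dist {x} {y} {d} = least (λ k → walk? k x y) d

record ClosedNeighbourhood (Γ : Graph) : Set where
  field
    near       : V Γ → V Γ → Bool
    near-sym   : ∀ u v → near u v ≡ near v u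
    near-refl  : ∀ u → near u u ≡ true
    adj⇒near   : ∀ {u v} → Adj Γ u v → near u v ≡ true
    near⇒≡⊎adj : ∀ {u v} → near u v ≡ true → u ≡ v ⊎ Adj Γ u v

module ClosedNeighbourhoodProperties {Γ : Graph} (N : ClosedNeighbourhood Γ) where
  open ClosedNeighbourhood N public
  open GraphProperties Γ

  near⇒adj : ∀ {u v} → near u v ≡ true → u ≢ v → Adj Γ u v
  near⇒adj n u≢v = [ (λ u≡v → contradiction u≡v u≢v) , id ] (near⇒≡⊎adj n)

  ¬adj⇒¬near : ∀ {u v} → u ≢ v → ¬ Adj Γ u v → near u v ≡ false
  ¬adj⇒¬near u≢v ¬adj = ¬-not (λ n → [ u≢v , ¬adj ] (near⇒≡⊎adj n))

  ¬near⇒2≤length : ∀ {u v j} → near u v ≡ false → Walk Γ u v j → 2 ≤ j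
  ¬near⇒2≤length nf (nil u)                  = contradiction (trans (sym (near-refl u)) nf) λ ()
  ¬near⇒2≤length nf (cons e (nil _))         = contradiction (trans (sym (adj⇒near e)) nf) λ ()
  ¬near⇒2≤length _  (cons _ (cons _ _))      = s≤s (s≤s z≤n)

  -- δ = false: u and v are closed twins; δ = true: their closed neighbourhoods are complementary.
  NearXor : Bool → V Γ → V Γ → Set
  NearXor δ u v = ∀ w → near u w ≡ δ xor near v w

  NearXor-sym : ∀ {δ u v} → NearXor δ u v → NearXor δ v u
  NearXor-sym {false} twin w = sym (twin w)
  NearXor-sym {true}  anti w = trans (sym (not-involutive _)) (cong not (sym (anti w)))

  complementary⇒3≤length : ∀ {u v j} → NearXor true u v → Walk Γ u v j → 3 ≤ j
  complementary⇒3≤length anti (nil u) = contradiction (anti u) (not-¬ refl)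
  complementary⇒3≤length {v = v} anti (cons e (nil _)) =
    contradiction (trans (sym (adj⇒near e)) (trans (anti v) (cong not (near-refl v)))) λ ()
  complementary⇒3≤length {v = v} anti (cons {y = w} e (cons e′ (nil _))) =
    contradiction (trans (sym (adj⇒near e)) (trans (anti w) (cong not (trans (near-sym v w) (adj⇒near e′))))) λ ()
  complementary⇒3≤length _ (cons _ (cons _ (cons _ _))) = s≤s (s≤s (s≤s z≤n))

  NearXor⇒maximallyDistant : ∀ {δ u v} → DiameterAtMost Γ 3 → u ≢ v → NearXor δ u v →
                             MaximallyDistantFrom Γ u v
  NearXor⇒maximallyDistant {false} {u} {v} _ u≢v twin (p , _) {w} e
    with near⇒≡⊎adj (trans (sym (twin w)) (adj⇒near e))
  ... | inj₁ refl = 0 , z≤n , nil v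
  ... | inj₂ e′   = 1 , ≢⇒1≤length (u≢v ∘ sym) p , edge e′
  NearXor⇒maximallyDistant {true} {v = v} diameter _ anti (p , _) {w} _ =
    let (k , k≤3 , q) = diameter v w
    in  k , ≤-trans k≤3 (complementary⇒3≤length (NearXor-sym anti) p) , q

  resolves-via-neighbour : ∀ {x y z} → y ≢ x → near y x ≡ true → x ≢ z → near x z ≡ true →
                           near y z ≡ false → StronglyResolves Γ x y z
  resolves-via-neighbour y≢x nyx x≢z nxz nyz =
    geodesic⇒resolves (adjacent⇒Dist1 y≢x (near⇒adj nyx y≢x)) (adjacent⇒Dist1 x≢z (near⇒adj nxz x≢z))
                      (λ _ → ¬near⇒2≤length nyz)

  resolves-via-antipode : ∀ {w x y z} → near y w ≡ true → near w x ≡ true → near y x ≡ false →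
                          x ≢ z → near x z ≡ true → NearXor true y z → StronglyResolves Γ x y z
  resolves-via-antipode {w} {x} {y} nyw nwx nyx x≢z nxz anti =
    geodesic⇒resolves (edge (near⇒adj nyw y≢w) ++ʷ edge (near⇒adj nwx w≢x) , λ _ → ¬near⇒2≤length nyx)
                      (adjacent⇒Dist1 x≢z (near⇒adj nxz x≢z))
                      (λ _ → complementary⇒3≤length anti)
    where
    y≢w : y ≢ w
    y≢w refl = contradiction (trans (sym nwx) nyx) λ ()
    w≢x : w ≢ x
    w≢x refl = contradiction (trans (sym nyw) nyx) λ ()

module _ {G H : Graph} where

  ◇-walkˡ : ∀ {g g′ h a} → Walk G g g′ a → Walk (G ◇ H) (g , h) (g′ , h) a
  ◇-walkˡ (nil _)    = nil _
  ◇-walkˡ (cons e p) = cons (inj₂ (inj₁ (e , refl))) (◇-walkˡ p)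

  ◇-walkʳ : ∀ {g h h′ b} → Walk H h h′ b → Walk (G ◇ H) (g , h) (g , h′) b
  ◇-walkʳ (nil _)    = nil _
  ◇-walkʳ (cons e q) = cons (inj₁ (refl , e)) (◇-walkʳ q)

  ◇-walk : ∀ {g g′ h h′ a b} → Walk G g g′ a → Walk H h h′ b → Walk (G ◇ H) (g , h) (g′ , h′) (a ⊔ b)
  ◇-walk (nil _)    q           = ◇-walkʳ q
  ◇-walk (cons e p) (nil _)     = ◇-walkˡ (cons e p)
  ◇-walk (cons e p) (cons e′ q) = cons (inj₂ (inj₂ (inj₁ (e , e′)))) (◇-walk p q)

  ◇-diameter : ∀ {d} → DiameterAtMost G d → DiameterAtMost H d → DiameterAtMost (G ◇ H) d
  ◇-diameter diamG diamH (g , h) (g′ , h′) =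
    let (a , a≤d , p) = diamG g g′
        (b , b≤d , q) = diamH h h′
    in  a ⊔ b , ⊔-lub a≤d b≤d , ◇-walk p q

  ◇-adj? : DecidableEquality (V G) → DecidableEquality (V H) →
           (∀ g g′ → Dec (Adj G g g′)) → (∀ h h′ → Dec (Adj H h h′)) → ∀ u v → Dec (Adj (G ◇ H) u v)
  ◇-adj? _≟ᴳ_ _≟ᴴ_ adjᴳ? adjᴴ? (g , h) (g′ , h′) =
        (g ≟ᴳ g′ ×-dec adjᴴ? h h′)
    ⊎-dec (adjᴳ? g g′ ×-dec h ≟ᴴ h′)
    ⊎-dec (adjᴳ? g g′ ×-dec adjᴴ? h h′)
    ⊎-dec (¬? (g ≟ᴳ g′) ×-dec ¬? (h ≟ᴴ h′) ×-dec ¬? (adjᴳ? g g′) ×-dec ¬? (adjᴴ? h h′))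

  module _ (NG : ClosedNeighbourhood G) (NH : ClosedNeighbourhood H) where
    private
      module NG = ClosedNeighbourhoodProperties NG
      module NH = ClosedNeighbourhoodProperties NH

    ◇-near : V (G ◇ H) → V (G ◇ H) → Bool
    ◇-near (g , h) (g′ , h′) = not (NG.near g g′ xor NH.near h h′)

    ◇-near-cong : ∀ {g h g′ h′ a b} → NG.near g g′ ≡ a → NH.near h h′ ≡ b →
                  ◇-near (g , h) (g′ , h′) ≡ not (a xor b)
    ◇-near-cong = cong₂ (λ a b → not (a xor b))

    ◇-closedNeighbourhood : ClosedNeighbourhood (G ◇ H)
    ◇-closedNeighbourhood = record
      { near       = ◇-near
      ; near-sym   = λ (g , h) (g′ , h′) → ◇-near-cong (NG.near-sym g g′) (NH.near-sym h h′)
      ; near-refl  = λ (g , h) → ◇-near-cong (NG.near-refl g) (NH.near-refl h)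
      ; adj⇒near   = adj⇒near
      ; near⇒≡⊎adj = near⇒≡⊎adj
      }
      where
      adj⇒near : ∀ {u v} → Adj (G ◇ H) u v → ◇-near u v ≡ true
      adj⇒near {g , _} (inj₁ (refl , e))      = ◇-near-cong (NG.near-refl g) (NH.adj⇒near e)
      adj⇒near {_ , h} (inj₂ (inj₁ (e , refl))) = ◇-near-cong (NG.adj⇒near e) (NH.near-refl h)
      adj⇒near (inj₂ (inj₂ (inj₁ (e , e′))))  = ◇-near-cong (NG.adj⇒near e) (NH.adj⇒near e′)
      adj⇒near (inj₂ (inj₂ (inj₂ (g≢g′ , h≢h′ , ¬e , ¬e′)))) =
        ◇-near-cong (NG.¬adj⇒¬near g≢g′ ¬e) (NH.¬adj⇒¬near h≢h′ ¬e′)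

      near⇒≡⊎adj : ∀ {u v} → ◇-near u v ≡ true → u ≡ v ⊎ Adj (G ◇ H) u v
      near⇒≡⊎adj {g , h} {g′ , h′} n with NG.near g g′ in ng | NH.near h h′ in nh
      ... | true | true with NG.near⇒≡⊎adj ng | NH.near⇒≡⊎adj nh
      ...   | inj₁ refl | inj₁ refl = inj₁ refl
      ...   | inj₁ refl | inj₂ e′   = inj₂ (inj₁ (refl , e′))
      ...   | inj₂ e    | inj₁ refl = inj₂ (inj₂ (inj₁ (e , refl)))
      ...   | inj₂ e    | inj₂ e′   = inj₂ (inj₂ (inj₂ (inj₁ (e , e′))))
      near⇒≡⊎adj {g , h} {g′ , h′} n | false | false =
        inj₂ (inj₂ (inj₂ (inj₂ ( (λ { refl → contradiction (trans (sym (NG.near-refl g)) ng) λ () })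
                               , (λ { refl → contradiction (trans (sym (NH.near-refl h)) nh) λ () })
                               , (λ e → contradiction (trans (sym (NG.adj⇒near e)) ng) λ ())
                               , (λ e → contradiction (trans (sym (NH.adj⇒near e)) nh) λ ())))))

    open ClosedNeighbourhoodProperties ◇-closedNeighbourhood using (NearXor)

    ◇-NearXor : ∀ {a b g g′ h h′} → NG.NearXor a g g′ → NH.NearXor b h h′ →
                NearXor (a xor b) (g , h) (g′ , h′)
    ◇-NearXor {a} {b} {g} {g′} {h} {h′} shiftᴳ shiftᴴ (x , y) = trans (◇-near-cong (shiftᴳ x) (shiftᴴ y))
                                                     (xnor-xor-interchange a b (NG.near g′ x) (NH.near h′ y))
      where
      xnor-xor-interchange : ∀ a b s t → not ((a xor s) xor (b xor t)) ≡ (a xor b) xor not (s xor t)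
      xnor-xor-interchange false false s t = refl
      xnor-xor-interchange true  false s t = cong not (sym (not-distribˡ-xor s t))
      xnor-xor-interchange false true  s t = cong not (sym (not-distribʳ-xor s t))
      xnor-xor-interchange true  true  s t = cong not (begin
        not s xor not t      ≡⟨ not-distribˡ-xor s (not t) ⟨
        not (s xor not t)    ≡⟨ cong not (not-distribʳ-xor s t) ⟨
        not (not (s xor t))  ≡⟨ not-involutive (s xor t) ⟩
        s xor t              ∎)
        where open ≡-Reasoning

module KnnMBlowupProperties (n : ℕ) (q r : Fin n → ℕ) where

  K : Graph
  K = KnnMBlowup n q r

  row : V K → Fin n
  row = proj₁

  side : V K → Bool
  side (_ , inj₁ _) = true
  side (_ , inj₂ _) = false

  _≟ᵛ_ : DecidableEquality (V K)
  _≟ᵛ_ = Product.≡-dec _≟_ (Sum.≡-dec _≟_ _≟_)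

  adj? : ∀ u v → Dec (Adj K u v)
  adj? u@(i , inj₁ _) v@(j , inj₁ _) = i ≟ j ×-dec ¬? (u ≟ᵛ v)
  adj? u@(i , inj₂ _) v@(j , inj₂ _) = i ≟ j ×-dec ¬? (u ≟ᵛ v)
  adj? (i , inj₁ _) (j , inj₂ _) = ¬? (i ≟ j)
  adj? (i , inj₂ _) (j , inj₁ _) = ¬? (i ≟ j)

  clique : ∀ i → List (Fin (q i) ⊎ Fin (r i))
  clique i = map inj₁ (allFin (q i)) ++ map inj₂ (allFin (r i))

  vertices : List (V K)
  vertices = allFinΣ n clique

  ∈-vertices : ∀ u → u ∈ vertices
  ∈-vertices (i , inj₁ a) = ∈-allFinΣ n clique (∈-++⁺ˡ (∈-map⁺ inj₁ (∈-allFin a)))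
  ∈-vertices (i , inj₂ b) =
    ∈-allFinΣ n clique (∈-++⁺ʳ (map inj₁ (allFin (q i))) (∈-map⁺ inj₂ (∈-allFin b)))

  vertices-Unique : Unique vertices
  vertices-Unique = allFinΣ-Unique n clique λ i →
    Unique.++⁺ (Unique.map⁺ Sum.inj₁-injective (Unique.allFin⁺ (q i)))
               (Unique.map⁺ Sum.inj₂-injective (Unique.allFin⁺ (r i)))
               disjoint
    where
    disjoint : ∀ {i v} → ¬ (v ∈ map inj₁ (allFin (q i)) × v ∈ map inj₂ (allFin (r i)))
    disjoint (v∈₁ , v∈₂) with ∈-map⁻ inj₁ v∈₁ | ∈-map⁻ inj₂ v∈₂
    ... | _ , _ , refl | _ , _ , ()

  length-vertices : length vertices ≡ ∑ n (λ i → q i + r i)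
  length-vertices = length-allFinΣ n clique λ i →
    trans (length-++ (map inj₁ (allFin (q i))))
          (cong₂ _+_ (trans (length-map inj₁ (allFin (q i))) (length-tabulate {n = q i} id))
                     (trans (length-map inj₂ (allFin (r i))) (length-tabulate {n = r i} id)))

  near : V K → V K → Bool
  near u v = does (row u ≟ row v) xor (side u xor side v)

  does-≟-sym : ∀ (i j : Fin n) → does (i ≟ j) ≡ does (j ≟ i)
  does-≟-sym i j with i ≟ j | j ≟ i
  ... | yes _   | yes _   = refl
  ... | no  _   | no  _   = refl
  ... | yes i≡j | no  j≢i = contradiction (sym i≡j) j≢i
  ... | no  i≢j | yes j≡i = contradiction (sym j≡i) i≢j

  near-refl : ∀ u → near u u ≡ true
  near-refl (i , x) = cong₂ _xor_ (dec-true (i ≟ i) refl) (xor-same (side (i , x)))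

  adj⇒near : ∀ {u v} → Adj K u v → near u v ≡ true
  adj⇒near {i , inj₁ _} {_ , inj₁ _} (refl , _) = cong (_xor false) (dec-true (i ≟ i) refl)
  adj⇒near {i , inj₂ _} {_ , inj₂ _} (refl , _) = cong (_xor false) (dec-true (i ≟ i) refl)
  adj⇒near {i , inj₁ _} {j , inj₂ _} i≢j = cong (_xor true) (dec-false (i ≟ j) i≢j)
  adj⇒near {i , inj₂ _} {j , inj₁ _} i≢j = cong (_xor true) (dec-false (i ≟ j) i≢j)

  near⇒≡⊎adj : ∀ {u v} → near u v ≡ true → u ≡ v ⊎ Adj K u v
  near⇒≡⊎adj {u@(i , inj₁ _)} {v@(j , inj₁ _)} n with i ≟ j
  ... | yes refl = map₂ (refl ,_) (toSum (u ≟ᵛ v))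
  ... | no  _    = contradiction n λ ()
  near⇒≡⊎adj {u@(i , inj₂ _)} {v@(j , inj₂ _)} n with i ≟ j
  ... | yes refl = map₂ (refl ,_) (toSum (u ≟ᵛ v))
  ... | no  _    = contradiction n λ ()
  near⇒≡⊎adj {i , inj₁ _} {j , inj₂ _} n with i ≟ j
  ... | yes _   = contradiction n λ ()
  ... | no  i≢j = inj₂ i≢j
  near⇒≡⊎adj {i , inj₂ _} {j , inj₁ _} n with i ≟ j
  ... | yes _   = contradiction n λ ()
  ... | no  i≢j = inj₂ i≢j

  closedNeighbourhood : ClosedNeighbourhood K
  closedNeighbourhood = record
    { near       = near
    ; near-sym   = λ u v → cong₂ _xor_ (does-≟-sym (row u) (row v)) (xor-comm (side u) (side v))
    ; near-refl  = near-refl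
    ; adj⇒near   = adj⇒near
    ; near⇒≡⊎adj = near⇒≡⊎adj
    }

  open ClosedNeighbourhoodProperties closedNeighbourhood using (NearXor)

  sameRow⇒NearXor : ∀ {u v} → row u ≡ row v → NearXor (side u xor side v) u v
  sameRow⇒NearXor {u} {v} row≡ w =
    trans (cong (λ i → does (i ≟ row w) xor (side u xor side w)) row≡)
          (xor-shift (does (row v ≟ row w)) (side u) (side v) (side w))

  module Nonempty (q>0 : ∀ i → 1 ≤ q i) (r>0 : ∀ i → 1 ≤ r i) where

    vertex : Fin n → Bool → V K
    vertex i b = i , (if b then inj₁ (fromℕ< (q>0 i)) else inj₂ (fromℕ< (r>0 i)))

    side-vertex : ∀ i b → side (vertex i b) ≡ b
    side-vertex i true  = refl
    side-vertex i false = refl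

    near-otherRow : ∀ {i k} b c → i ≢ k → near (vertex i b) (vertex k c) ≡ b xor c
    near-otherRow {i} {k} b c i≢k =
      cong₂ _xor_ (dec-false (i ≟ k) i≢k) (cong₂ _xor_ (side-vertex i b) (side-vertex k c))

    sameSide-walk : 3 ≤ n → ∀ {u v} → side u ≡ side v → Walk K u v 2
    sameSide-walk 3≤n {i , inj₁ _} {j , inj₁ _} _ =
      let (t , t≢i , t≢j) = avoid₂ 3≤n i j in cons {y = vertex t false} (t≢i ∘ sym) (cons t≢j (nil _))
    sameSide-walk 3≤n {i , inj₂ _} {j , inj₂ _} _ =
      let (t , t≢i , t≢j) = avoid₂ 3≤n i j in cons {y = vertex t true} (t≢i ∘ sym) (cons t≢j (nil _))

    oppositeSide-walk : 3 ≤ n → ∀ {u v} → side u ≢ side v → Walk K u v 3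
    oppositeSide-walk _   {_ , inj₁ _} {_ , inj₁ _} s≢ = contradiction refl s≢
    oppositeSide-walk _   {_ , inj₂ _} {_ , inj₂ _} s≢ = contradiction refl s≢
    oppositeSide-walk 3≤n {i , inj₁ _} {_ , inj₂ _} _ =
      let (t , t≢i , _) = avoid₂ 3≤n i i in cons {y = vertex t false} (t≢i ∘ sym) (sameSide-walk 3≤n refl)
    oppositeSide-walk 3≤n {i , inj₂ _} {_ , inj₁ _} _ =
      let (t , t≢i , _) = avoid₂ 3≤n i i in cons {y = vertex t true} (t≢i ∘ sym) (sameSide-walk 3≤n refl)

    diameter≤3 : 3 ≤ n → DiameterAtMost K 3
    diameter≤3 3≤n u v with side u Bool.≟ side v
    ... | yes s≡ = 2 , s≤s (s≤s z≤n) , sameSide-walk 3≤n s≡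
    ... | no  s≢ = 3 , ≤-refl , oppositeSide-walk 3≤n s≢

module KnnMBlowupProduct
  (n m : ℕ) (3≤n : 3 ≤ n) (3≤m : 3 ≤ m) (q r : Fin n → ℕ) (s p : Fin m → ℕ)
  (q>0 : ∀ i → 1 ≤ q i) (r>0 : ∀ i → 1 ≤ r i) (s>0 : ∀ j → 1 ≤ s j) (p>0 : ∀ j → 1 ≤ p j) where

  private
    module A = KnnMBlowupProperties n q r
    module B = KnnMBlowupProperties m s p
    module Aₙ = A.Nonempty q>0 r>0
    module Bₙ = B.Nonempty s>0 p>0

  P : Graph
  P = A.K ◇ B.K

  open GraphProperties P
  open ClosedNeighbourhoodProperties (◇-closedNeighbourhood A.closedNeighbourhood B.closedNeighbourhood)

  private
    near-pair : ∀ g h g′ h′ {a b} → A.near g g′ ≡ a → B.near h h′ ≡ b →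
                near (g , h) (g′ , h′) ≡ not (a xor b)
    near-pair g h g′ h′ = ◇-near-cong A.closedNeighbourhood B.closedNeighbourhood {g} {h} {g′} {h′}
    xᴬ yᴬ : Fin n → V A.K
    xᴬ i = Aₙ.vertex i true
    yᴬ i = Aₙ.vertex i false
    xᴮ yᴮ : Fin m → V B.K
    xᴮ j = Bₙ.vertex j true
    yᴮ j = Bₙ.vertex j false

  _≟ᵖ_ : DecidableEquality (V P)
  _≟ᵖ_ = Product.≡-dec A._≟ᵛ_ B._≟ᵛ_

  vertices : List (V P)
  vertices = cartesianProduct A.vertices B.vertices

  ∈-vertices : ∀ u → u ∈ vertices
  ∈-vertices (g , h) = ∈-cartesianProduct⁺ (A.∈-vertices g) (B.∈-vertices h)

  vertices-Unique : Unique vertices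
  vertices-Unique = Unique.cartesianProduct⁺ A.vertices-Unique B.vertices-Unique

  length-vertices : length vertices ≡ ∑ n (λ i → (q i + r i) * ∑ m (λ j → s j + p j))
  length-vertices = trans (length-cartesianProduct A.vertices B.vertices)
                          (trans (cong₂ _*_ A.length-vertices B.length-vertices) (∑-*ʳ n _ _))

  diameter≤3 : DiameterAtMost P 3
  diameter≤3 = ◇-diameter (Aₙ.diameter≤3 3≤n) (Bₙ.diameter≤3 3≤m)

  distance : ∀ u v → ∃[ k ] Dist P u v k
  distance u v = let (_ , _ , w) = diameter≤3 u v in
    walk⇒Dist _≟ᵖ_ (◇-adj? A._≟ᵛ_ B._≟ᵛ_ A.adj? B.adj?) vertices ∈-vertices w

  Block : Set
  Block = Fin n × Fin m

  block : V P → Block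
  block (g , h) = A.row g , B.row h

  blocks : List Block
  blocks = cartesianProduct (allFin n) (allFin m)

  length-blocks : length blocks ≡ n * m
  length-blocks = trans (length-cartesianProduct (allFin n) (allFin m))
                        (cong₂ _*_ (length-tabulate {n = n} id) (length-tabulate {n = m} id))

  parity : V P → V P → Bool
  parity (g , h) (g′ , h′) = (A.side g xor A.side g′) xor (B.side h xor B.side h′)

  sameBlock⇒NearXor : ∀ {u v} → block u ≡ block v → NearXor (parity u v) u v
  sameBlock⇒NearXor {g , h} {g′ , h′} same = ◇-NearXor A.closedNeighbourhood B.closedNeighbourhood
    {A.side g xor A.side g′} {B.side h xor B.side h′} {g} {g′} {h} {h′}
    (A.sameRow⇒NearXor {g} {g′} (cong proj₁ same)) (B.sameRow⇒NearXor {h} {h′} (cong proj₂ same))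

  resolving-lower-bound : ∀ S → IsStrongResolving P S → length vertices ≤ n * m + length S
  resolving-lower-bound S resolving =
    subst (λ k → length vertices ≤ k + length S) length-blocks
      (length≤fibres+hittingSet _≟ᵖ_ block blocks (λ _ → ∈-cartesianProduct⁺ (∈-allFin _) (∈-allFin _))
         vertices-Unique S
         λ x≢y same → strongResolving-meets resolving x≢y (maximallyDistant same x≢y)
                                             (maximallyDistant (sym same) (x≢y ∘ sym)))
    where
    maximallyDistant : ∀ {u v} → block u ≡ block v → u ≢ v → MaximallyDistantFrom P u v
    maximallyDistant {u} {v} same u≢v =
      NearXor⇒maximallyDistant {parity u v} diameter≤3 u≢v (sameBlock⇒NearXor {u} {v} same)

  rep : Block → V P
  rep (i , j) = xᴬ i , xᴮ j

  IsRep : V P → Set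
  IsRep u = ∃[ b ] u ≡ rep b

  isRep? : Decidable IsRep
  isRep? u = map′ (block u ,_) (λ { (_ , refl) → refl }) (u ≟ᵖ rep (block u))

  resolvingSet : List (V P)
  resolvingSet = filter (∁? isRep?) vertices

  ∈-resolvingSet : ∀ {u} → ¬ IsRep u → u ∈ resolvingSet
  ∈-resolvingSet ¬rep = ∈-filter⁺ (∁? isRep?) (∈-vertices _) ¬rep

  length-resolvingSet : length resolvingSet + n * m ≤ length vertices
  length-resolvingSet = begin
    length resolvingSet + n * m                           ≤⟨ +-mono-≤ ≤-refl blocks≤reps ⟩
    length resolvingSet + length (filter isRep? vertices) ≡⟨ +-comm (length resolvingSet) _ ⟩
    length (filter isRep? vertices) + length resolvingSet ≡⟨ length-filter+∁ isRep? vertices ⟩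
    length vertices                                       ∎
    where
    open ≤-Reasoning
    blocks≤reps : n * m ≤ length (filter isRep? vertices)
    blocks≤reps = subst (_≤ length (filter isRep? vertices)) length-blocks
      (length-injection rep (Unique.cartesianProduct⁺ (Unique.allFin⁺ n) (Unique.allFin⁺ m))
         (λ _ _ → cong block) (λ {b} _ → ∈-filter⁺ isRep? (∈-vertices (rep b)) (b , refl)))

  -- rep (k , l) – rep (i , j) – (x_i , y′_t) is a geodesic of length 2.
  resolved-acrossBlocks : ∀ {i j k l t} → i ≢ k → j ≢ l → t ≢ j → t ≢ l →
                          StronglyResolves P (rep (i , j)) (rep (k , l)) (xᴬ i , yᴮ t)
  resolved-acrossBlocks {i} {j} {k} {l} {t} i≢k j≢l t≢j t≢l =
    resolves-via-neighbour (λ e → i≢k (cong (proj₁ ∘ block) (sym e)))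
      (near-pair (xᴬ k) (xᴮ l) (xᴬ i) (xᴮ j) (Aₙ.near-otherRow true true (i≢k ∘ sym))
                                             (Bₙ.near-otherRow true true (j≢l ∘ sym)))
      (λ ())
      (near-pair (xᴬ i) (xᴮ j) (xᴬ i) (yᴮ t) (A.near-refl (xᴬ i)) (Bₙ.near-otherRow true false (t≢j ∘ sym)))
      (near-pair (xᴬ k) (xᴮ l) (xᴬ i) (yᴮ t) (Aₙ.near-otherRow true true (i≢k ∘ sym))
                                             (Bₙ.near-otherRow true false (t≢l ∘ sym)))

  -- rep (i , l) – (x_i , y′_t) – rep (i , j) – (x_i , y′_l) is a geodesic, its ends being antipodal.
  resolved-sameRowᴬ : ∀ {i j l t} → j ≢ l → t ≢ j → t ≢ l →
                      StronglyResolves P (rep (i , j)) (rep (i , l)) (xᴬ i , yᴮ l)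
  resolved-sameRowᴬ {i} {j} {l} {t} j≢l t≢j t≢l =
    resolves-via-antipode {xᴬ i , yᴮ t} {xᴬ i , xᴮ j} {xᴬ i , xᴮ l} {xᴬ i , yᴮ l}
      (near-pair (xᴬ i) (xᴮ l) (xᴬ i) (yᴮ t) (A.near-refl (xᴬ i)) (Bₙ.near-otherRow true false (t≢l ∘ sym)))
      (near-pair (xᴬ i) (yᴮ t) (xᴬ i) (xᴮ j) (A.near-refl (xᴬ i)) (Bₙ.near-otherRow false true t≢j))
      (near-pair (xᴬ i) (xᴮ l) (xᴬ i) (xᴮ j) (A.near-refl (xᴬ i)) (Bₙ.near-otherRow true true (j≢l ∘ sym)))
      (λ ())
      (near-pair (xᴬ i) (xᴮ j) (xᴬ i) (yᴮ l) (A.near-refl (xᴬ i)) (Bₙ.near-otherRow true false j≢l))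
      (sameBlock⇒NearXor {xᴬ i , xᴮ l} {xᴬ i , yᴮ l} refl)

  resolved-sameRowᴮ : ∀ {i j k t} → i ≢ k → t ≢ i → t ≢ k →
                      StronglyResolves P (rep (i , j)) (rep (k , j)) (yᴬ k , xᴮ j)
  resolved-sameRowᴮ {i} {j} {k} {t} i≢k t≢i t≢k =
    resolves-via-antipode {yᴬ t , xᴮ j} {xᴬ i , xᴮ j} {xᴬ k , xᴮ j} {yᴬ k , xᴮ j}
      (near-pair (xᴬ k) (xᴮ j) (yᴬ t) (xᴮ j) (Aₙ.near-otherRow true false (t≢k ∘ sym)) (B.near-refl (xᴮ j)))
      (near-pair (yᴬ t) (xᴮ j) (xᴬ i) (xᴮ j) (Aₙ.near-otherRow false true t≢i) (B.near-refl (xᴮ j)))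
      (near-pair (xᴬ k) (xᴮ j) (xᴬ i) (xᴮ j) (Aₙ.near-otherRow true true (i≢k ∘ sym)) (B.near-refl (xᴮ j)))
      (λ ())
      (near-pair (xᴬ i) (xᴮ j) (yᴬ k) (xᴮ j) (Aₙ.near-otherRow true false i≢k) (B.near-refl (xᴮ j)))
      (sameBlock⇒NearXor {xᴬ k , xᴮ j} {yᴬ k , xᴮ j} refl)

  reps-resolved : ∀ b b′ → rep b ≢ rep b′ →
                  ∃[ z ] (z ∈ resolvingSet × StronglyResolves P (rep b) (rep b′) z)
  reps-resolved (i , j) (k , l) x≢y with i ≟ k | j ≟ l
  ... | yes refl | yes refl = contradiction refl x≢y
  ... | no i≢k   | no j≢l   = let (t , t≢j , t≢l) = avoid₂ 3≤m j l in
    (xᴬ i , yᴮ t) , ∈-resolvingSet (λ { (_ , ()) }) , resolved-acrossBlocks i≢k j≢l t≢j t≢l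
  ... | yes refl | no j≢l   = let (t , t≢j , t≢l) = avoid₂ 3≤m j l in
    (xᴬ i , yᴮ l) , ∈-resolvingSet (λ { (_ , ()) }) , resolved-sameRowᴬ j≢l t≢j t≢l
  ... | no i≢k   | yes refl = let (t , t≢i , t≢k) = avoid₂ 3≤n i k in
    (yᴬ k , xᴮ j) , ∈-resolvingSet (λ { (_ , ()) }) , resolved-sameRowᴮ i≢k t≢i t≢k

  resolvingSet-resolving : IsStrongResolving P resolvingSet
  resolvingSet-resolving x y x≢y with isRep? x | isRep? y
  ... | no ¬rep | _       = x , ∈-resolvingSet ¬rep , resolves-self (proj₂ (distance y x))
  ... | yes _   | no ¬rep = y , ∈-resolvingSet ¬rep , StronglyResolves-sym (resolves-self (proj₂ (distance x y)))
  ... | yes (b , refl) | yes (b′ , refl) = reps-resolved b b′ x≢y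

  strongMetricDim : StrongMetricDim P (length vertices ∸ n * m)
  strongMetricDim =
    ( resolvingSet
    , Unique.filter⁺ (∁? isRep?) vertices-Unique
    , resolvingSet-resolving
    , ≤-antisym (m+n≤o⇒m≤o∸n (length resolvingSet) length-resolvingSet)
                (m≤n+o⇒m∸n≤o (length vertices) (n * m) (resolving-lower-bound resolvingSet resolvingSet-resolving)))
    , λ S _ resolving → m≤n+o⇒m∸n≤o (length vertices) (n * m) (resolving-lower-bound S resolving)

corollary4p11 : (n m : ℕ) → 3 ≤ n → 3 ≤ m →
    (q r : Fin n → ℕ) → (s p : Fin m → ℕ) →
    (∀ i → 1 ≤ q i) → (∀ i → 1 ≤ r i) → (∀ j → 1 ≤ s j) → (∀ j → 1 ≤ p j) →
    StrongMetricDim (KnnMBlowup n q r ◇ KnnMBlowup m s p)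
      (∑ n (λ i → (q i + r i) * ∑ m (λ j → s j + p j)) ∸ n * m)
corollary4p11 n m 3≤n 3≤m q r s p q>0 r>0 s>0 p>0 =
  subst (λ k → StrongMetricDim P (k ∸ n * m)) length-vertices strongMetricDim
  where open KnnMBlowupProduct n m 3≤n 3≤m q r s p q>0 r>0 s>0 p>0
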